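{- Let $k\leqslant 2$ and $n>k$ be natural numbers. Then every graph $G$ on $n$ vertices satisfies $h_k(G)\geqslant f_0(n,k)$.
   Context: All graphs are finite, undirected, without loops or multiple edges. For a graph $G$ and a natural number $k$, $h_k(G)$ denotes the number of unordered pairs of distinct vertices of $G$ whose degrees differ by less than $k$. For natural numbers $n>k$, $$f_0(n,k):=\left(\left\lceil \tfrac{n}{k} \right\rceil - 2\right)\binom{k}{2} + \binom{k+1}{2} + \binom{n-k \left( \left\lceil\frac{n}{k} \right\rceil - 1 \right)-1}{2},$$ where $\binom{m}{2}=m(m-1)/2$. -}

module Defs where

open import Data.Nat using (ℕ; zero; suc; _+_; _*_; _∸_; _<_; _<?_; NonZero; ∣_-_∣)
open import Data.Nat.DivMod using (_/_)
open import Data.Nat.Combinatorics using (_C_)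
open import Data.Bool using (Bool; true; false; if_then_else_)
open import Data.Fin using (Fin; toℕ)
open import Data.List using (List; map; allFin)
open import Data.Nat.ListAction using (sum)
open import Relation.Nullary.Decidable using (does)
open import Relation.Binary.PropositionalEquality using (_≡_)

record Graph (n : ℕ) : Set where
  field
    adj   : Fin n → Fin n → Bool
    sym   : ∀ i j → adj i j ≡ adj j i
    irrefl : ∀ i → adj i i ≡ false
open Graph public

deg : ∀ {n} → Graph n → Fin n → ℕ
deg {n} G i = sum (map (λ j → if adj G i j then 1 else 0) (allFin n))

ind : Bool → ℕ
ind b = if b then 1 else 0

h : ℕ → ∀ {n} → Graph n → ℕ
h k {n} G = sum (map (λ i → sum (map (λ j →
    ind (does (toℕ i <? toℕ j)) * ind (does (∣ deg G i - deg G j ∣ <? k)))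
    (allFin n))) (allFin n))

choose2 : ℕ → ℕ
choose2 m = m C 2

ceilDiv : (n k : ℕ) → .{{NonZero k}} → ℕ
ceilDiv n k = (n + (k ∸ 1)) / k

f0 : (n k : ℕ) → .{{NonZero k}} → ℕ
f0 n k = (ceilDiv n k ∸ 2) * choose2 k + choose2 (k + 1)
         + choose2 (n ∸ k * (ceilDiv n k ∸ 1) ∸ 1)

-- h_k(G) depends only on the degree list of G, and counting close pairs is monotone under
-- taking sublists. Numbers in a window [a, a + k) are pairwise k-close, so m of them give
-- C(m,2) ≥ m - 1 close pairs for k = 1 and C(m,2) ≥ 2m - 3 for k = 2; cutting a window of width
-- K·k into K windows of width k, m numbers in it give at least m - K resp. 2m - 3K close pairs.
-- The degrees of a graph on n vertices lie in [0, n - 1], and a vertex of degree 0 excludes one of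
-- degree n - 1, so they lie in a window of width n - 1; this settles k = 1 and k = 2 with n odd.
-- For n even one needs n - 1 degrees in a window of width n - 2: two isolated vertices push every
-- degree below n - 2, two dominating vertices push every degree up to at least 2, and otherwise
-- at most one vertex has degree 0 or n - 1 while the others lie in [1, n - 2]. With n = 2K + 1
-- or n = 2K + 2 this gives 2(2K + 1) - 3K = K + 2 = f0(n, 2) close pairs.
{-# OPTIONS --safe #-}
module Submission where

open import Defs hiding (sym)
open import Data.Nat.Properties
open import Algebra.Properties.CommutativeMonoid.Sum +-0-commutativeMonoid
  using (sum-syntax; ∑-distrib-+; sum-cong-≗)
open import Algebra.Properties.CommutativeSemigroup +-commutativeSemigroup
  using (x∙yz≈y∙xz; interchange)
open import Data.Bool using (Bool; true; false)
open import Data.Fin using (Fin; zero; suc; toℕ)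
open import Data.Fin.Properties using (any?)
open import Data.List using (List; []; _∷_; map; allFin; tabulate; length; filter)
open import Data.List.Properties using (map-tabulate; length-tabulate; filter-all; filter-none)
open import Data.List.Relation.Binary.Sublist.Propositional
  using (_⊆_; []; _∷_; _∷ʳ_; ⊆-refl; ⊆-trans)
open import Data.List.Relation.Binary.Sublist.Propositional.Properties
  using (filter-⊆; filter⁺; length-mono-≤)
open import Data.List.Relation.Unary.All as All using (All; []; _∷_)
open import Data.List.Relation.Unary.All.Properties using (tabulate⁺; all-filter)
  renaming (filter⁺ to all-filter⁺)
open import Data.Nat
open import Data.Nat.DivMod
  using (_/_; _divMod_; result; +-distrib-/-∣ʳ; m<n⇒m/n≡0; m*n/n≡m; n/1≡n)
open import Data.Nat.Divisibility using (n∣m*n)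
open import Data.Nat.ListAction using (sum)
open import Data.Nat.Tactic.RingSolver using (solve-∀)
open import Data.Product using (∃₂; _×_; _,_; proj₁)
open import Data.Sum using (inj₁; inj₂)
open import Function using (_∘_; id)
open import Relation.Binary.PropositionalEquality
open import Relation.Nullary using (Dec; yes; no; ¬_; ¬?; does; contradiction)
open import Relation.Unary using (Pred; Decidable)

variable
  A : Set
  n : ℕ

sum-tabulate : (f : Fin n → ℕ) → sum (tabulate f) ≡ ∑[ i < n ] f i
sum-tabulate {zero} f = refl
sum-tabulate {suc n} f = cong (f zero +_) (sum-tabulate (f ∘ suc))

sum-map-allFin : (f : Fin n → ℕ) → sum (map f (allFin n)) ≡ ∑[ i < n ] f i
sum-map-allFin f = trans (cong sum (map-tabulate id f)) (sum-tabulate f)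

∑-mono-≤ : {f g : Fin n → ℕ} → (∀ i → f i ≤ g i) → ∑[ i < n ] f i ≤ ∑[ i < n ] g i
∑-mono-≤ {zero} f≤g = z≤n
∑-mono-≤ {suc n} f≤g = +-mono-≤ (f≤g zero) (∑-mono-≤ (f≤g ∘ suc))

∑≡0⇒≡0 : {f : Fin n → ℕ} → ∑[ i < n ] f i ≡ 0 → ∀ i → f i ≡ 0
∑≡0⇒≡0 {suc n} {f} ∑≡0 zero = m+n≡0⇒m≡0 (f zero) ∑≡0
∑≡0⇒≡0 {suc n} {f} ∑≡0 (suc i) = ∑≡0⇒≡0 (m+n≡0⇒n≡0 (f zero) ∑≡0) i

∑-≤1 : {f : Fin n → ℕ} → (∀ i → f i ≤ 1) → ∑[ i < n ] f i ≤ n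
∑-≤1 {zero} f≤1 = z≤n
∑-≤1 {suc n} f≤1 = +-mono-≤ (f≤1 zero) (∑-≤1 (f≤1 ∘ suc))

∑-≤1-< : {f : Fin n → ℕ} → (∀ i → f i ≤ 1) → ∀ v → f v ≡ 0 → ∑[ i < n ] f i < n
∑-≤1-< f≤1 zero fv≡0 rewrite fv≡0 = s≤s (∑-≤1 (f≤1 ∘ suc))
∑-≤1-< f≤1 (suc v) fv≡0 = +-mono-≤-< (f≤1 zero) (∑-≤1-< (f≤1 ∘ suc) v fv≡0)

∑-≤1-<-pred : {f : Fin n → ℕ} → (∀ i → f i ≤ 1) → ∀ {v w} → v ≢ w → f v ≡ 0 → f w ≡ 0 →
              ∑[ i < n ] f i < pred n
∑-≤1-<-pred f≤1 {zero} {zero} v≢w _ _ = contradiction refl v≢w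
∑-≤1-<-pred f≤1 {zero} {suc w} _ fv≡0 fw≡0 rewrite fv≡0 = ∑-≤1-< (f≤1 ∘ suc) w fw≡0
∑-≤1-<-pred f≤1 {suc v} {zero} _ fv≡0 fw≡0 rewrite fw≡0 = ∑-≤1-< (f≤1 ∘ suc) v fv≡0
∑-≤1-<-pred {suc (suc n)} f≤1 {suc v} {suc w} v≢w fv≡0 fw≡0 =
  +-mono-≤-< (f≤1 zero) (∑-≤1-<-pred (f≤1 ∘ suc) (v≢w ∘ cong suc) fv≡0 fw≡0)

ind≤1 : ∀ b → ind b ≤ 1
ind≤1 true = ≤-refl
ind≤1 false = z≤n

ind≡0⇒false : ∀ {b} → ind b ≡ 0 → b ≡ false
ind≡0⇒false {false} _ = refl

module _ {p} {P : Set p} where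

  ind-does-no : (P? : Dec P) → ¬ P → ind (does P?) ≡ 0
  ind-does-no (yes p) ¬p = contradiction p ¬p
  ind-does-no (no _) _ = refl

  ind-does-≤ : (P? : Dec P) {b : Bool} → (P → b ≡ true) → ind (does P?) ≤ ind b
  ind-does-≤ (yes p) P⇒b rewrite P⇒b p = ≤-refl
  ind-does-≤ (no _) _ = z≤n

  ind+ind-does≤1 : (b : Bool) (P? : Dec P) → (P → b ≡ false) → ind b + ind (does P?) ≤ 1
  ind+ind-does≤1 b (yes p) P⇒¬b rewrite P⇒¬b p = ≤-refl
  ind+ind-does≤1 b (no _) _ = subst (_≤ 1) (sym (+-identityʳ (ind b))) (ind≤1 b)

module _ {p} {P : Pred A p} (P? : Decidable P) where

  length-filter-tabulate : (f : Fin n → A) →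
                           length (filter P? (tabulate f)) ≡ ∑[ i < n ] ind (does (P? (f i)))
  length-filter-tabulate {zero} f = refl
  length-filter-tabulate {suc n} f with does (P? (f zero))
  ... | true = cong suc (length-filter-tabulate (f ∘ suc))
  ... | false = length-filter-tabulate (f ∘ suc)

  length-filter-+-¬ : ∀ xs → length (filter P? xs) + length (filter (¬? ∘ P?) xs) ≡ length xs
  length-filter-+-¬ [] = refl
  length-filter-+-¬ (x ∷ xs) with does (P? x)
  ... | true = cong suc (length-filter-+-¬ xs)
  ... | false = trans (+-suc _ _) (cong suc (length-filter-+-¬ xs))

  length-filter-mono-⊆ : {xs ys : List A} → xs ⊆ ys → length (filter P? xs) ≤ length (filter P? ys)
  length-filter-mono-⊆ xs⊆ys = length-mono-≤ (filter⁺ P? P? (λ { refl Px → Px }) xs⊆ys)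

Close : ℕ → ℕ → ℕ → Set
Close k x y = ∣ x - y ∣ < k

close? : ∀ k x → Decidable (Close k x)
close? k x y = ∣ x - y ∣ <? k

closePairs : ℕ → List ℕ → ℕ
closePairs k [] = 0
closePairs k (x ∷ xs) = length (filter (close? k x) xs) + closePairs k xs

closePairs-mono-⊆ : ∀ k {xs ys : List ℕ} → xs ⊆ ys → closePairs k xs ≤ closePairs k ys
closePairs-mono-⊆ k [] = z≤n
closePairs-mono-⊆ k (y ∷ʳ xs⊆ys) = ≤-trans (closePairs-mono-⊆ k xs⊆ys) (m≤n+m _ _)
closePairs-mono-⊆ k {x ∷ xs} (refl ∷ xs⊆ys) =
  +-mono-≤ (length-filter-mono-⊆ (close? k x) xs⊆ys) (closePairs-mono-⊆ k xs⊆ys)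

closePairs-filter-+-¬ : ∀ k {p} {P : Pred ℕ p} (P? : Decidable P) xs →
  closePairs k (filter P? xs) + closePairs k (filter (¬? ∘ P?) xs) ≤ closePairs k xs
closePairs-filter-+-¬ k P? [] = z≤n
closePairs-filter-+-¬ k P? (x ∷ xs) with does (P? x)
... | true = begin
  closeTo ys + closePairs k ys + closePairs k zs    ≡⟨ +-assoc (closeTo ys) _ _ ⟩
  closeTo ys + (closePairs k ys + closePairs k zs)
    ≤⟨ +-mono-≤ (length-filter-mono-⊆ (close? k x) (filter-⊆ P? xs))
                (closePairs-filter-+-¬ k P? xs) ⟩
  closeTo xs + closePairs k xs                      ∎
  where
  open ≤-Reasoning
  ys = filter P? xs
  zs = filter (¬? ∘ P?) xs
  closeTo = length ∘ filter (close? k x)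
... | false = begin
  closePairs k ys + (closeTo zs + closePairs k zs)  ≡⟨ x∙yz≈y∙xz (closePairs k ys) (closeTo zs) _ ⟩
  closeTo zs + (closePairs k ys + closePairs k zs)
    ≤⟨ +-mono-≤ (length-filter-mono-⊆ (close? k x) (filter-⊆ (¬? ∘ P?) xs))
                (closePairs-filter-+-¬ k P? xs) ⟩
  closeTo xs + closePairs k xs                      ∎
  where
  open ≤-Reasoning
  ys = filter P? xs
  zs = filter (¬? ∘ P?) xs
  closeTo = length ∘ filter (close? k x)

InWindow : ℕ → ℕ → ℕ → Set
InWindow a w x = a ≤ x × x < a + w

inWindow-∸ : ∀ {a w x y} → InWindow a w x → a ≤ y → x ∸ y < w
inWindow-∸ {a} {w} {x} {y} (a≤x , x<a+w) a≤y = begin-strict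
  x ∸ y       ≤⟨ ∸-monoʳ-≤ x a≤y ⟩
  x ∸ a       <⟨ ∸-monoˡ-< x<a+w a≤x ⟩
  a + w ∸ a   ≡⟨ m+n∸m≡n a w ⟩
  w           ∎
  where open ≤-Reasoning

inWindow⇒close : ∀ {a k x y} → InWindow a k x → InWindow a k y → Close k x y
inWindow⇒close {k = k} {x} {y} x∈ y∈ with ∣m-n∣≡[m∸n]∨[n∸m] x y
... | inj₁ eq = subst (_< k) (sym eq) (inWindow-∸ x∈ (proj₁ y∈))
... | inj₂ eq = subst (_< k) (sym eq) (inWindow-∸ y∈ (proj₁ x∈))

closePairs-∷-inWindow : ∀ {a k x xs} → All (InWindow a k) (x ∷ xs) →
                        closePairs k (x ∷ xs) ≡ length xs + closePairs k xs
closePairs-∷-inWindow {k = k} {x} {xs} (x∈ ∷ xs∈) = cong (λ ys → length ys + closePairs k xs)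
  (filter-all (close? k x) (All.map (inWindow⇒close x∈) xs∈))

PairBound : (k w α β : ℕ) → Set
PairBound k w α β = ∀ {a xs} → All (InWindow a w) xs → α * length xs ≤ closePairs k xs + β

pairBound-empty : ∀ {k α} → PairBound k 0 α 0
pairBound-empty {α = α} [] = ≤-reflexive (*-zeroʳ α)
pairBound-empty {a = a} ((a≤x , x<a+0) ∷ _) =
  contradiction (subst (_ <_) (+-identityʳ a) x<a+0) (≤⇒≯ a≤x)

pairBound-window₁ : ∀ {k} → PairBound k k 1 1
pairBound-window₁ [] = z≤n
pairBound-window₁ {k} {xs = x ∷ xs} xs∈ = begin
  1 * suc (length xs)                      ≡⟨ *-identityˡ _ ⟩
  suc (length xs)                          ≡⟨ +-comm 1 (length xs) ⟩
  length xs + 1                            ≤⟨ +-monoˡ-≤ 1 (m≤m+n _ _) ⟩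
  length xs + closePairs k xs + 1          ≡⟨ cong (_+ 1) (closePairs-∷-inWindow xs∈) ⟨
  closePairs k (x ∷ xs) + 1                ∎
  where open ≤-Reasoning

pairBound-window₂ : ∀ {k} → PairBound k k 2 3
pairBound-window₂ [] = z≤n
pairBound-window₂ {k} {xs = x ∷ xs} xs∈@(_ ∷ tail∈) = begin
  2 * suc (length xs)                      ≡⟨ rearrange (length xs) ⟩
  length xs + 1 * length xs + 2            ≤⟨ +-monoˡ-≤ 2 (+-monoʳ-≤ (length xs) (pairBound-window₁ tail∈)) ⟩
  length xs + (closePairs k xs + 1) + 2    ≡⟨ regroup (length xs) (closePairs k xs) ⟩
  length xs + closePairs k xs + 3          ≡⟨ cong (_+ 3) (closePairs-∷-inWindow xs∈) ⟨
  closePairs k (x ∷ xs) + 3                ∎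
  where
  open ≤-Reasoning
  rearrange : ∀ m → 2 * suc m ≡ m + 1 * m + 2
  rearrange = solve-∀
  regroup : ∀ m c → m + (c + 1) + 2 ≡ m + c + 3
  regroup = solve-∀

pairBound-+ : ∀ {k w v α β γ} → PairBound k w α β → PairBound k v α γ →
              PairBound k (w + v) α (β + γ)
pairBound-+ {k} {w} {v} {α} {β} {γ} bound₁ bound₂ {a} {xs} xs∈ = begin
  α * length xs                                     ≡⟨ cong (α *_) (length-filter-+-¬ low? xs) ⟨
  α * (length lows + length highs)                  ≡⟨ *-distribˡ-+ α (length lows) _ ⟩
  α * length lows + α * length highs                ≤⟨ +-mono-≤ (bound₁ lows∈) (bound₂ highs∈) ⟩
  closePairs k lows + β + (closePairs k highs + γ)  ≡⟨ interchange (closePairs k lows) β _ γ ⟩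
  closePairs k lows + closePairs k highs + (β + γ)  ≤⟨ +-monoˡ-≤ (β + γ) (closePairs-filter-+-¬ k low? xs) ⟩
  closePairs k xs + (β + γ)                         ∎
  where
  open ≤-Reasoning
  low? : Decidable (_< a + w)
  low? x = x <? a + w
  lows = filter low? xs
  highs = filter (¬? ∘ low?) xs
  lows∈ : All (InWindow a w) lows
  lows∈ = All.zipWith (λ ((a≤x , _) , x<a+w) → a≤x , x<a+w)
    (all-filter⁺ low? xs∈ , all-filter low? xs)
  highs∈ : All (InWindow (a + w) v) highs
  highs∈ = All.zipWith
    (λ ((_ , x<a+[w+v]) , x≮a+w) → ≮⇒≥ x≮a+w , subst (_<_ _) (sym (+-assoc a w v)) x<a+[w+v])
    (all-filter⁺ (¬? ∘ low?) xs∈ , all-filter (¬? ∘ low?) xs)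

pairBound-* : ∀ {k w α β} → PairBound k w α β → ∀ K → PairBound k (K * w) α (K * β)
pairBound-* {α = α} bound zero = pairBound-empty {α = α}
pairBound-* {α = α} bound (suc K) = pairBound-+ {α = α} bound (pairBound-* {α = α} bound K)

DenseWindow : (m w : ℕ) → List ℕ → Set
DenseWindow m w xs = ∃₂ λ a ys → ys ⊆ xs × m ≤ length ys × All (InWindow a w) ys

denseWindow-≤ : ∀ {m m′ w xs} → m′ ≤ m → DenseWindow m w xs → DenseWindow m′ w xs
denseWindow-≤ m′≤m (a , ys , ys⊆xs , m≤|ys| , ys∈) = a , ys , ys⊆xs , ≤-trans m′≤m m≤|ys| , ys∈

pairBound-dense : ∀ {k w α β m xs} → PairBound k w α β → DenseWindow m w xs →
                  α * m ≤ closePairs k xs + β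
pairBound-dense {k} {α = α} {β} {m} {xs} bound (a , ys , ys⊆xs , m≤|ys| , ys∈) = begin
  α * m                 ≤⟨ *-monoʳ-≤ α m≤|ys| ⟩
  α * length ys         ≤⟨ bound ys∈ ⟩
  closePairs k ys + β   ≤⟨ +-monoˡ-≤ β (closePairs-mono-⊆ k ys⊆xs) ⟩
  closePairs k xs + β   ∎
  where open ≤-Reasoning

denseWindow⇒closePairs₁ : ∀ {W xs} → DenseWindow (suc W) W xs → 1 ≤ closePairs 1 xs
denseWindow⇒closePairs₁ {W} {xs} dense = +-cancelʳ-≤ W 1 (closePairs 1 xs) (begin
  suc W                     ≡⟨ *-identityˡ (suc W) ⟨
  1 * suc W                 ≤⟨ pairBound-dense {α = 1} (pairBound-* {α = 1} pairBound-window₁ W) dense′ ⟩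
  closePairs 1 xs + W * 1   ≡⟨ cong (closePairs 1 xs +_) (*-identityʳ W) ⟩
  closePairs 1 xs + W       ∎)
  where
  open ≤-Reasoning
  dense′ : DenseWindow (suc W) (W * 1) xs
  dense′ = subst (λ w → DenseWindow (suc W) w xs) (sym (*-identityʳ W)) dense

denseWindow⇒closePairs₂ : ∀ {K xs} → DenseWindow (suc (K * 2)) (K * 2) xs → K + 2 ≤ closePairs 2 xs
denseWindow⇒closePairs₂ {K} {xs} dense = +-cancelʳ-≤ (K * 3) (K + 2) (closePairs 2 xs) (begin
  K + 2 + K * 3             ≡⟨ rearrange K ⟩
  2 * suc (K * 2)           ≤⟨ pairBound-dense {α = 2} (pairBound-* {α = 2} pairBound-window₂ K) dense ⟩
  closePairs 2 xs + K * 3   ∎)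
  where
  open ≤-Reasoning
  rearrange : ∀ K → K + 2 + K * 3 ≡ 2 * suc (K * 2)
  rearrange = solve-∀

degrees : Graph n → List ℕ
degrees G = tabulate (deg G)

orderedPairSum≡closePairs : ∀ k (d : Fin n → ℕ) →
  ∑[ i < n ] ∑[ j < n ] (ind (does (toℕ i <? toℕ j)) * ind (does (close? k (d i) (d j))))
    ≡ closePairs k (tabulate d)
orderedPairSum≡closePairs {zero} k d = refl
orderedPairSum≡closePairs {suc n} k d = cong₂ _+_ firstRow (orderedPairSum≡closePairs k (d ∘ suc))
  where
  firstRow = trans (sum-cong-≗ {n} (λ j → +-identityʳ (ind (does (close? k (d zero) (d (suc j)))))))
                   (sym (length-filter-tabulate (close? k (d zero)) (d ∘ suc)))

h≡closePairs : ∀ k (G : Graph n) → h k G ≡ closePairs k (degrees G)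
h≡closePairs {n} k G = trans (sum-map-allFin (λ i → sum (map (pair i) (allFin n))))
  (trans (sum-cong-≗ (sum-map-allFin ∘ pair)) (orderedPairSum≡closePairs k (deg G)))
  where
  pair : Fin n → Fin n → ℕ
  pair i j = ind (does (toℕ i <? toℕ j)) * ind (does (close? k (deg G i) (deg G j)))

deg≡∑ : (G : Graph n) (v : Fin n) → deg G v ≡ ∑[ j < n ] ind (adj G v j)
deg≡∑ G v = sum-map-allFin (ind ∘ adj G v)

deg<n : (G : Graph n) (v : Fin n) → deg G v < n
deg<n G v = subst (_< _) (sym (deg≡∑ G v)) (∑-≤1-< (ind≤1 ∘ adj G v) v (cong ind (irrefl G v)))

deg≡0⇒¬adj : (G : Graph n) {i : Fin n} → deg G i ≡ 0 → ∀ v → adj G i v ≡ false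
deg≡0⇒¬adj G {i} isolated v = ind≡0⇒false (∑≡0⇒≡0 (trans (sym (deg≡∑ G i)) isolated) v)

deg≡n∸1⇒adj : (G : Graph n) {i v : Fin n} → deg G i ≡ n ∸ 1 → i ≢ v → adj G i v ≡ true
deg≡n∸1⇒adj G {i} {v} full i≢v with adj G i v in i≁v
... | true = refl
... | false = contradiction (subst (_< _) (trans (sym (deg≡∑ G i)) full) fewer) (<-irrefl refl)
  where
  fewer = ∑-≤1-<-pred (ind≤1 ∘ adj G i) i≢v (cong ind (irrefl G i)) (cong ind i≁v)

isolated⇒¬full : 2 ≤ n → (G : Graph n) {i j : Fin n} → deg G i ≡ 0 → deg G j ≢ n ∸ 1
isolated⇒¬full (s≤s (s≤s _)) G {i} {j} isolated full = contradiction
  (trans (sym (deg≡n∸1⇒adj G full j≢i)) (trans (Graph.sym G j i) (deg≡0⇒¬adj G isolated j))) λ ()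
  where
  j≢i : j ≢ i
  j≢i refl = contradiction (trans (sym isolated) full) λ ()

isolatedCount : Graph n → ℕ
isolatedCount G = length (filter (_≟ 0) (degrees G))

fullCount : Graph n → ℕ
fullCount {n} G = length (filter (_≟ n ∸ 1) (degrees G))

deg+isolatedCount<n : (G : Graph n) (v : Fin n) → deg G v ≢ 0 → deg G v + isolatedCount G < n
deg+isolatedCount<n {n} G v v≢0 = begin-strict
  deg G v + isolatedCount G
    ≡⟨ cong₂ _+_ (deg≡∑ G v) (length-filter-tabulate (_≟ 0) (deg G)) ⟩
  ∑[ j < n ] ind (adj G v j) + ∑[ j < n ] ind (does (deg G j ≟ 0))
    ≡⟨ ∑-distrib-+ (ind ∘ adj G v) (λ j → ind (does (deg G j ≟ 0))) ⟨
  ∑[ j < n ] (ind (adj G v j) + ind (does (deg G j ≟ 0)))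
    <⟨ ∑-≤1-< term≤1 v term-v≡0 ⟩
  n ∎
  where
  open ≤-Reasoning
  term≤1 : ∀ j → ind (adj G v j) + ind (does (deg G j ≟ 0)) ≤ 1
  term≤1 j = ind+ind-does≤1 (adj G v j) (deg G j ≟ 0)
    (λ isolated → trans (Graph.sym G v j) (deg≡0⇒¬adj G isolated v))
  term-v≡0 : ind (adj G v v) + ind (does (deg G v ≟ 0)) ≡ 0
  term-v≡0 = cong₂ _+_ (cong ind (irrefl G v)) (ind-does-no (deg G v ≟ 0) v≢0)

fullCount≤deg : (G : Graph n) (v : Fin n) → deg G v ≢ n ∸ 1 → fullCount G ≤ deg G v
fullCount≤deg {n} G v v≢n∸1 = begin
  fullCount G                                  ≡⟨ length-filter-tabulate (_≟ n ∸ 1) (deg G) ⟩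
  ∑[ j < n ] ind (does (deg G j ≟ n ∸ 1))      ≤⟨ ∑-mono-≤ term≤ ⟩
  ∑[ j < n ] ind (adj G v j)                   ≡⟨ deg≡∑ G v ⟨
  deg G v                                      ∎
  where
  open ≤-Reasoning
  term≤ : ∀ j → ind (does (deg G j ≟ n ∸ 1)) ≤ ind (adj G v j)
  term≤ j = ind-does-≤ (deg G j ≟ n ∸ 1)
    (λ full → trans (Graph.sym G v j) (deg≡n∸1⇒adj G full (λ { refl → v≢n∸1 full })))

isolatedCount+fullCount≤1 : 2 ≤ n → (G : Graph n) → isolatedCount G ≤ 1 → fullCount G ≤ 1 →
                            isolatedCount G + fullCount G ≤ 1
isolatedCount+fullCount≤1 2≤n G z≤1 u≤1 with any? (λ i → deg G i ≟ 0)
... | yes (i , isolated) =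
  +-mono-≤ z≤1 (subst (fullCount G ≤_) isolated (fullCount≤deg G i (isolated⇒¬full 2≤n G isolated)))
... | no ∄isolated = +-mono-≤ (≤-reflexive z≡0) u≤1
  where
  z≡0 : isolatedCount G ≡ 0
  z≡0 = cong length (filter-none (_≟ 0) (tabulate⁺ (λ v isolated → ∄isolated (v , isolated))))

degrees-denseWindow : ∀ {a w} (G : Graph n) → (∀ v → InWindow a w (deg G v)) →
                      DenseWindow n w (degrees G)
degrees-denseWindow G inWindow =
  _ , degrees G , ⊆-refl , ≤-reflexive (sym (length-tabulate (deg G))) , tabulate⁺ inWindow

degrees-denseWindow-∸1 : 2 ≤ n → (G : Graph n) → DenseWindow n (n ∸ 1) (degrees G)
degrees-denseWindow-∸1 2≤n@(s≤s _) G with any? (λ i → deg G i ≟ 0)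
... | yes (i , isolated) = degrees-denseWindow G
  (λ v → z≤n , ≤∧≢⇒< (<⇒≤pred (deg<n G v)) (isolated⇒¬full 2≤n G isolated))
... | no ∄isolated = degrees-denseWindow G (λ v → n≢0⇒n>0 (∄isolated ∘ (v ,_)) , deg<n G v)

degrees-interior : 2 ≤ n → (G : Graph n) → isolatedCount G + fullCount G ≤ 1 →
                   DenseWindow (n ∸ 1) (n ∸ 2) (degrees G)
degrees-interior {n} (s≤s (s≤s _)) G z+u≤1 =
  1 , interior , ⊆-trans (filter-⊆ ¬full? nonIsolated) (filter-⊆ ¬isolated? D) , long ,
  All.zipWith inWindow (all-filter⁺ ¬full? (all-filter⁺ ¬isolated? (tabulate⁺ (deg<n G))) ,
    All.zip (all-filter⁺ ¬full? (all-filter ¬isolated? D) , all-filter ¬full? nonIsolated))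
  where
  D = degrees G
  ¬isolated? : Decidable (_≢ 0)
  ¬isolated? = ¬? ∘ (_≟ 0)
  ¬full? : Decidable (_≢ n ∸ 1)
  ¬full? = ¬? ∘ (_≟ n ∸ 1)
  nonIsolated = filter ¬isolated? D
  interior = filter ¬full? nonIsolated
  long : n ∸ 1 ≤ length interior
  long = m≤n+o⇒m∸n≤o n 1 (begin
    n                                                     ≡⟨ length-tabulate (deg G) ⟨
    length D                                              ≡⟨ length-filter-+-¬ (_≟ 0) D ⟨
    isolatedCount G + length nonIsolated
      ≡⟨ cong (isolatedCount G +_) (length-filter-+-¬ (_≟ n ∸ 1) nonIsolated) ⟨
    isolatedCount G + (length (filter (_≟ n ∸ 1) nonIsolated) + length interior)
      ≤⟨ +-monoʳ-≤ (isolatedCount G) (+-monoˡ-≤ (length interior)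
           (length-filter-mono-⊆ (_≟ n ∸ 1) (filter-⊆ ¬isolated? D))) ⟩
    isolatedCount G + (fullCount G + length interior)     ≡⟨ +-assoc (isolatedCount G) _ _ ⟨
    isolatedCount G + fullCount G + length interior       ≤⟨ +-monoˡ-≤ (length interior) z+u≤1 ⟩
    1 + length interior                                   ∎)
    where open ≤-Reasoning
  inWindow : ∀ {x} → x < n × x ≢ 0 × x ≢ n ∸ 1 → InWindow 1 (n ∸ 2) x
  inWindow (x<n , x≢0 , x≢n∸1) = n≢0⇒n>0 x≢0 , ≤∧≢⇒< (<⇒≤pred x<n) x≢n∸1

degrees-denseWindow-∸2 : 3 ≤ n → (G : Graph n) → DenseWindow (n ∸ 1) (n ∸ 2) (degrees G)
degrees-denseWindow-∸2 {n} (s≤s 2≤n-1@(s≤s (s≤s _))) G with 2 ≤? isolatedCount G | 2 ≤? fullCount G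
... | yes 2≤z | _ = denseWindow-≤ (m∸n≤m n 1) (degrees-denseWindow G (λ v → z≤n , low v))
  where
  low : ∀ v → deg G v < n ∸ 2
  low v with deg G v ≟ 0
  ... | yes v≡0 = subst (_< n ∸ 2) (sym v≡0) (s≤s z≤n)
  ... | no v≢0 = m+n≤o⇒m≤o∸n (suc (deg G v))
    (≤-trans (+-monoʳ-≤ (suc (deg G v)) 2≤z) (deg+isolatedCount<n G v v≢0))
... | no _ | yes 2≤u = denseWindow-≤ (m∸n≤m n 1) (degrees-denseWindow G (λ v → high v , deg<n G v))
  where
  high : ∀ v → 2 ≤ deg G v
  high v with deg G v ≟ n ∸ 1
  ... | yes full = subst (2 ≤_) (sym full) 2≤n-1
  ... | no ¬full = ≤-trans 2≤u (fullCount≤deg G v ¬full)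
... | no z≱2 | no u≱2 = degrees-interior (s≤s (s≤s z≤n)) G
  (isolatedCount+fullCount≤1 (s≤s (s≤s z≤n)) G (≤-pred (≰⇒> z≱2)) (≤-pred (≰⇒> u≱2)))

f0-one : ∀ m → f0 (suc m) 1 ≡ 1
f0-one m = begin
  f0 (suc m) 1
    ≡⟨ cong (λ c → (c ∸ 2) * 0 + 1 + choose2 (suc m ∸ 1 * (c ∸ 1) ∸ 1)) ceilDiv≡ ⟩
  (m ∸ 1) * 0 + 1 + choose2 (suc m ∸ (m + 0) ∸ 1)
    ≡⟨ cong₂ (λ a b → a + 1 + choose2 (suc m ∸ b ∸ 1)) (*-zeroʳ (m ∸ 1)) (+-identityʳ m) ⟩
  1 + choose2 (suc m ∸ m ∸ 1)
    ≡⟨ cong (λ d → 1 + choose2 (d ∸ 1)) (m+n∸n≡m 1 m) ⟩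
  1 ∎
  where
  open ≡-Reasoning
  ceilDiv≡ : ceilDiv (suc m) 1 ≡ suc m
  ceilDiv≡ = trans (cong (_/ 1) (+-identityʳ (suc m))) (n/1≡n (suc m))

ceilDiv-two : ∀ r M → r ≤ 1 → ceilDiv (suc r + M * 2) 2 ≡ suc M
ceilDiv-two r M r≤1 = begin
  (suc r + M * 2 + 1) / 2       ≡⟨ cong (_/ 2) (shift r (M * 2)) ⟩
  (r + suc M * 2) / 2           ≡⟨ +-distrib-/-∣ʳ r (n∣m*n (suc M)) ⟩
  r / 2 + suc M * 2 / 2         ≡⟨ cong₂ _+_ (m<n⇒m/n≡0 (s≤s r≤1)) (m*n/n≡m (suc M) 2) ⟩
  suc M                         ∎
  where
  open ≡-Reasoning
  shift : ∀ r x → suc r + x + 1 ≡ r + (2 + x)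
  shift = solve-∀

choose2≡0 : ∀ {r} → r ≤ 1 → choose2 r ≡ 0
choose2≡0 z≤n = refl
choose2≡0 (s≤s z≤n) = refl

f0-two : ∀ r K → r ≤ 1 → f0 (suc r + suc K * 2) 2 ≡ suc K + 2
f0-two r K r≤1 = begin
  f0 (suc r + M * 2) 2
    ≡⟨ cong (λ c → (c ∸ 2) * 1 + 3 + choose2 (suc r + M * 2 ∸ 2 * (c ∸ 1) ∸ 1))
            (ceilDiv-two r M r≤1) ⟩
  K * 1 + 3 + choose2 (suc r + M * 2 ∸ 2 * M ∸ 1)
    ≡⟨ cong₂ (λ a b → a + 3 + choose2 (suc r + M * 2 ∸ b ∸ 1)) (*-identityʳ K) (*-comm 2 M) ⟩
  K + 3 + choose2 (suc r + M * 2 ∸ M * 2 ∸ 1)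
    ≡⟨ cong (λ d → K + 3 + choose2 (d ∸ 1)) (m+n∸n≡m (suc r) (M * 2)) ⟩
  K + 3 + choose2 r
    ≡⟨ cong (K + 3 +_) (choose2≡0 r≤1) ⟩
  K + 3 + 0
    ≡⟨ shift K ⟩
  suc K + 2 ∎
  where
  open ≡-Reasoning
  M = suc K
  shift : ∀ K → K + 3 + 0 ≡ suc K + 2
  shift = solve-∀

2<⇒≡1+r+[1+K]*2 : 2 < n → ∃₂ λ r K → r ≤ 1 × n ≡ suc r + suc K * 2
2<⇒≡1+r+[1+K]*2 {n} 2<n with n divMod 2
... | result (suc (suc K)) zero refl = 1 , K , ≤-refl , refl
... | result (suc K) (suc zero) refl = 0 , K , z≤n , refl
... | result zero zero refl = contradiction 2<n (≤⇒≯ z≤n)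
... | result (suc zero) zero refl = contradiction 2<n (≤⇒≯ ≤-refl)
... | result zero (suc zero) refl = contradiction 2<n (≤⇒≯ (s≤s z≤n))

degrees-denseWindow-K*2 : ∀ r K → r ≤ 1 → (G : Graph (suc r + suc K * 2)) →
                          DenseWindow (suc (suc K * 2)) (suc K * 2) (degrees G)
degrees-denseWindow-K*2 zero K z≤n G = degrees-denseWindow-∸1 (s≤s (s≤s z≤n)) G
degrees-denseWindow-K*2 (suc zero) K (s≤s z≤n) G = degrees-denseWindow-∸2 (s≤s (s≤s (s≤s z≤n))) G

theorem2 : (k n : ℕ) → .{{_ : NonZero k}} → k ≤ 2 → k < n →
    (G : Graph n) → f0 n k ≤ h k G
theorem2 zero _ ⦃ () ⦄ _ _ _
theorem2 (suc zero) (suc m) _ (s≤s 1≤m) G = begin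
  f0 (suc m) 1               ≡⟨ f0-one m ⟩
  1                          ≤⟨ denseWindow⇒closePairs₁ (degrees-denseWindow-∸1 (s≤s 1≤m) G) ⟩
  closePairs 1 (degrees G)   ≡⟨ h≡closePairs 1 G ⟨
  h 1 G                      ∎
  where open ≤-Reasoning
theorem2 (suc (suc zero)) n _ 2<n G with 2<⇒≡1+r+[1+K]*2 2<n
... | r , K , r≤1 , refl = begin
  f0 (suc r + suc K * 2) 2   ≡⟨ f0-two r K r≤1 ⟩
  suc K + 2                  ≤⟨ denseWindow⇒closePairs₂ (degrees-denseWindow-K*2 r K r≤1 G) ⟩
  closePairs 2 (degrees G)   ≡⟨ h≡closePairs 2 G ⟨
  h 2 G                      ∎
  where open ≤-Reasoning
theorem2 (suc (suc (suc _))) _ (s≤s (s≤s ())) _ _
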